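{- Let $n,t$ be positive integers and let $A,B\in\binom{[n]}{t+1}$ with $A\setminus B=\{1,2\}$ and $B\setminus A=\{3,4\}$. For each $(i,x)\in [4]\times ([n]\setminus [4])$: (i) $|\mathcal{D}_{\mathcal{E}}(X_{i,x};t)|=3$; moreover, if $x\notin A\cup B$ then $\mathcal{D}_{\mathcal{E}}(X_{i,x};t)=\{E\in\mathcal{E}: i\notin E\}$, and if $x\in A\cap B$ then $\mathcal{D}_{\mathcal{E}}(X_{i,x};t)=\{E\in\mathcal{E}: i\in E\}$; (ii) $2\leq |\mathcal{D}_{\mathcal{E}\setminus\{X_{2,4}\}}(X_{i,x};t)|\leq 3$; moreover, $|\mathcal{D}_{\mathcal{E}\setminus\{X_{2,4}\}}(X_{i,x};t)|=3$ if and only if $(i,x)\in I$.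
   Context: For a family $\mathcal{G}$ and $H\subseteq[n]$, $\mathcal{D}_{\mathcal{G}}(H;t)=\{G\in\mathcal{G}: |G\cap H|<t\}$. For $i\in[4]$ and $x\in[n]\setminus\{i\}$ put $X_{i,x}=(A\cap B)\cup\{i,x\}$ if $x\notin A\cap B$, and $X_{i,x}=(A\cup B)\setminus\{i,x\}$ if $x\in A\cap B$. $\mathcal{E}=\{X_{i,x}:\{i,x\}\in\binom{[4]}{2}\}$. $I=(\{1,3\}\times (A\cap B))\cup(\{2,4\}\times([n]\setminus(A\cup B)))$. -}

module Defs where

open import Data.Nat using (ℕ; zero; suc; _+_; _<ᵇ_)
open import Data.Bool using (Bool; true; false; _∧_; _∨_; not; if_then_else_)
open import Data.Fin using (Fin; _↑ˡ_; #_)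
open import Data.Fin.Subset
  using (Subset; inside; outside; ⁅_⁆; _∩_; _∪_; _─_; ∣_∣; _∈_; _∉_)
open import Data.Fin.Subset.Properties using (_∈?_)
open import Data.Vec using ([]; _∷_)
open import Data.Vec.Properties using (≡-dec)
import Data.Bool.Properties as BoolP
open import Data.List using (List; []; _∷_; map; _++_; filter; length)
open import Data.Product using (_×_)
open import Data.Sum using (_⊎_)
open import Relation.Nullary using (does)
open import Relation.Nullary.Decidable using (⌊_⌋)
open import Relation.Binary.PropositionalEquality using (_≡_)

-- Ground set [n] is modelled by Fin n; the paper's element k ∈ [n]
-- corresponds to the Fin index k - 1.  In particular the paper's
-- 1,2,3,4 are the Fin elements 0,1,2,3.

_=ˢ_ : ∀ {n} → Subset n → Subset n → Bool
S =ˢ T = ⌊ ≡-dec BoolP._≟_ S T ⌋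

_∈ᵇ_ : ∀ {n} → Fin n → Subset n → Bool
x ∈ᵇ S = ⌊ x ∈? S ⌋

Family : ℕ → Set
Family n = Subset n → Bool

allSubsets : (n : ℕ) → List (Subset n)
allSubsets zero    = [] ∷ []
allSubsets (suc n) = map (inside ∷_) (allSubsets n) ++ map (outside ∷_) (allSubsets n)

card : ∀ {n} → Family n → ℕ
card {n} F = length (filter (λ G → F G ≡? true) (allSubsets n))
  where
  _≡?_ = BoolP._≟_

_∖ᶠ_ : ∀ {n} → Family n → Subset n → Family n
(F ∖ᶠ H) G = F G ∧ not (G =ˢ H)

𝒟 : ∀ {n} → Family n → Subset n → ℕ → Family n
𝒟 F H t G = F G ∧ (∣ G ∩ H ∣ <ᵇ t)

X : ∀ {n} → Subset n → Subset n → Fin n → Fin n → Subset n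
X A B i x =
  if x ∈ᵇ (A ∩ B)
  then (A ∪ B) ─ (⁅ i ⁆ ∪ ⁅ x ⁆)
  else (A ∩ B) ∪ (⁅ i ⁆ ∪ ⁅ x ⁆)

ι : ∀ {m} → Fin 4 → Fin (4 + m)
ι {m} i = i ↑ˡ m

ℰ : ∀ {m} → Subset (4 + m) → Subset (4 + m) → Family (4 + m)
ℰ {m} A B G =
     (G =ˢ X A B (ι (# 0)) (ι (# 1))) ∨ (G =ˢ X A B (ι (# 0)) (ι (# 2)))
  ∨ (G =ˢ X A B (ι (# 0)) (ι (# 3))) ∨ (G =ˢ X A B (ι (# 1)) (ι (# 2)))
  ∨ (G =ˢ X A B (ι (# 1)) (ι (# 3))) ∨ (G =ˢ X A B (ι (# 2)) (ι (# 3)))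

I : ∀ {m} → Subset (4 + m) → Subset (4 + m) → Fin 4 → Fin (4 + m) → Set
I A B i x =
    ((i ≡ # 0 ⊎ i ≡ # 2) × x ∈ (A ∩ B))
  ⊎ ((i ≡ # 1 ⊎ i ≡ # 3) × x ∉ (A ∪ B))

{-# OPTIONS --safe #-}
-- Write A = {1,2} ∪ C and B = {3,4} ∪ C with C = A ∩ B, so |C| = t − 1 and
-- every member of ℰ is X_{j,k} = {j,k} ∪ C.  For x ∉ A ∪ B we have
-- X_{i,x} = {i,x} ∪ C, hence |E ∩ X_{i,x}| = |C| + [i ∈ E]; for x ∈ A ∩ B we
-- have X_{i,x} = ([4] ∖ {i}) ∪ (C ∖ {x}), hence |E ∩ X_{i,x}| = |C| + 1 − [i ∈ E].
-- So E ∈ ℰ is below the threshold t exactly when i ∉ E, resp. i ∈ E, and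
-- each i lies in three of the six pairs.  Deleting X_{2,4} lowers the count
-- by [X_{2,4} ∈ 𝒟], which is 0 exactly when (i, x) ∈ I.
module Submission where

open import Defs
open import Data.Nat using (ℕ; zero; suc; _+_; _≤_; _<ᵇ_; s≤s)
open import Data.Nat.Properties using (+-assoc; +-suc; +-identityʳ; ≤-refl; n≤1+n)
open import Data.Bool using (Bool; true; false; _∧_; _∨_; not; T)
open import Data.Bool.Properties using (_≟_; T-≡; T-∨; ∧-zeroʳ; ∧-identityʳ; ∧-comm; ∧-distribʳ-∨)
open import Data.Fin using (Fin; zero; suc; toℕ; #_; _↑ˡ_; _↑ʳ_)
open import Data.Fin.Subset
  using (Subset; inside; outside; ⊥; ⊤; ⁅_⁆; _∩_; _∪_; _─_; _-_; ∣_∣; _∈_; _∉_)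
open import Data.Fin.Subset.Properties
  using (_∈?_; x∈p∩q⁺; x∈p∩q⁻; x∈p∪q⁺; x∈p∪q⁻; ∣⊥∣≡0; p─⊥≡p;
         ∩-idem; ∩-zeroʳ; ∩-identityʳ; ∩-abs-∪; ∪-idem; ∪-identityˡ; ∪-identityʳ)
open import Data.Vec using (_∷_; []; _++_; lookup; here; there)
open import Data.Vec.Properties using (≡-dec; ∷-injectiveʳ; zipWith-++; lookup-++ˡ; []=⇒lookup)
open import Data.List as List using (List; _∷_; []; length; filter)
open import Data.List.Properties using (map-cong; map-++; map-∘)
open import Data.Nat.ListAction using (sum)
open import Data.Nat.ListAction.Properties using (sum-++)
open import Data.List.Membership.Propositional using () renaming (_∈_ to _∈ₗ_)
open import Data.List.Relation.Unary.All as All using (All; _∷_; [])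
open import Data.List.Relation.Unary.All.Properties using (map⁺)
open import Data.List.Relation.Unary.AllPairs using (AllPairs; _∷_; [])
open import Data.List.Relation.Unary.Any using (here; there)
open import Data.Product using (_×_; _,_; proj₁; ∃-syntax)
open import Data.Sum using (_⊎_; inj₁; inj₂; [_,_]′; reduce)
open import Function using (_∘_)
open import Function.Bundles using (_⇔_; mk⇔; Equivalence)
open import Function.Construct.Composition using (_⇔-∘_)
open import Function.Construct.Symmetry using (⇔-sym)
open import Relation.Nullary using (yes; no; does; contradiction)
open import Relation.Nullary.Decidable using (isYes≗does; dec-true; ⌊⌋-map′; toWitness)
open import Relation.Binary.PropositionalEquality
  using (_≡_; refl; sym; trans; cong; cong₂; subst; module ≡-Reasoning)

open ≡-Reasoning

private
  variable
    k m n : ℕ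

⟦_⟧ : Bool → ℕ
⟦ true  ⟧ = 1
⟦ false ⟧ = 0

<ᵇ-⟦⟧+ : ∀ b a → (a <ᵇ ⟦ b ⟧ + a) ≡ b
<ᵇ-⟦⟧+ true  zero    = refl
<ᵇ-⟦⟧+ false zero    = refl
<ᵇ-⟦⟧+ true  (suc a) = <ᵇ-⟦⟧+ true a
<ᵇ-⟦⟧+ false (suc a) = <ᵇ-⟦⟧+ false a

<ᵇ-by-⟦⟧ : ∀ b {a t} → ⟦ b ⟧ + a ≡ t → (a <ᵇ t) ≡ b
<ᵇ-by-⟦⟧ b refl = <ᵇ-⟦⟧+ b _

⟦not⟧+⟦⟧+ : ∀ b s → ⟦ not b ⟧ + (⟦ b ⟧ + s) ≡ suc s
⟦not⟧+⟦⟧+ true  s = refl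
⟦not⟧+⟦⟧+ false s = refl

two-or-three : ∀ {b n} {P : Set} → ⟦ b ⟧ + n ≡ 3 → (b ≡ false ⇔ P)
  → 2 ≤ n × n ≤ 3 × (n ≡ 3 ⇔ P)
two-or-three {true}  refl b⇔P =
  ≤-refl , n≤1+n 2 , mk⇔ (λ ()) (λ p → contradiction (Equivalence.from b⇔P p) λ ())
two-or-three {false} refl b⇔P =
  n≤1+n 2 , ≤-refl , mk⇔ (λ _ → Equivalence.to b⇔P refl) (λ _ → refl)

-- Counting subfamilies of the power set

count : Family n → List (Subset n) → ℕ
count F Gs = sum (List.map (⟦_⟧ ∘ F) Gs)

card≡count : (F : Family n) → card F ≡ count F (allSubsets n)
card≡count {n} F = go (allSubsets n)
  where
  go : (Gs : List (Subset n)) → length (filter (λ G → F G ≟ true) Gs) ≡ count F Gs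
  go []       = refl
  go (G ∷ Gs) with F G
  ... | true  = cong suc (go Gs)
  ... | false = go Gs

count-cong : {F F′ : Family n} → (∀ G → F G ≡ F′ G) → ∀ Gs → count F Gs ≡ count F′ Gs
count-cong F≗F′ Gs = cong sum (map-cong (cong ⟦_⟧ ∘ F≗F′) Gs)

count-++ : (F : Family n) (Gs Gs′ : List (Subset n))
  → count F (Gs List.++ Gs′) ≡ count F Gs + count F Gs′
count-++ F Gs Gs′ =
  trans (cong sum (map-++ (⟦_⟧ ∘ F) Gs Gs′)) (sum-++ (List.map (⟦_⟧ ∘ F) Gs) _)

count-map : (F : Family n) (f : Subset k → Subset n) (Gs : List (Subset k))
  → count F (List.map f Gs) ≡ count (F ∘ f) Gs
count-map F f Gs = cong sum (sym (map-∘ Gs))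

count-false : (Gs : List (Subset n)) → count (λ _ → false) Gs ≡ 0
count-false []       = refl
count-false (_ ∷ Gs) = count-false Gs

count-∨ : {F F′ : Family n} → (∀ G → F G ∧ F′ G ≡ false)
  → ∀ Gs → count (λ G → F G ∨ F′ G) Gs ≡ count F Gs + count F′ Gs
count-∨ disjoint [] = refl
count-∨ {F = F} {F′} disjoint (G ∷ Gs) with F G | F′ G | disjoint G
... | true  | false | _ = cong suc (count-∨ disjoint Gs)
... | false | true  | _ = trans (cong suc (count-∨ disjoint Gs)) (sym (+-suc _ _))
... | false | false | _ = count-∨ disjoint Gs

card-cong : {F F′ : Family n} → (∀ G → F G ≡ F′ G) → card F ≡ card F′
card-cong {n} {F} {F′} F≗F′ =
  trans (card≡count F) (trans (count-cong F≗F′ (allSubsets n)) (sym (card≡count F′)))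

card-false : card {n} (λ _ → false) ≡ 0
card-false {n} = trans (card≡count {n} (λ _ → false)) (count-false (allSubsets n))

card-∨ : {F F′ : Family n} → (∀ G → F G ∧ F′ G ≡ false)
  → card (λ G → F G ∨ F′ G) ≡ card F + card F′
card-∨ {n} {F} {F′} disjoint =
  trans (card≡count (λ G → F G ∨ F′ G))
    (trans (count-∨ disjoint (allSubsets n)) (sym (cong₂ _+_ (card≡count F) (card≡count F′))))

=ˢ-refl : (S : Subset n) → S =ˢ S ≡ true
=ˢ-refl S = trans (isYes≗does (≡-dec _≟_ S S)) (dec-true (≡-dec _≟_ S S) refl)

=ˢ-∧ : (G S : Subset n) (f : Family n) → (G =ˢ S) ∧ f G ≡ (G =ˢ S) ∧ f S
=ˢ-∧ G S f with ≡-dec _≟_ G S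
... | yes refl = refl
... | no  _    = refl

∷-=ˢ-∷ : ∀ b (G S : Subset n) → (b ∷ G) =ˢ (b ∷ S) ≡ G =ˢ S
∷-=ˢ-∷ b G S = begin
  (b ∷ G) =ˢ (b ∷ S)                   ≡⟨ isYes≗does _ ⟩
  does (b ≟ b) ∧ does (≡-dec _≟_ G S)  ≡⟨ cong (_∧ _) (dec-true (b ≟ b) refl) ⟩
  does (≡-dec _≟_ G S)                 ≡⟨ isYes≗does _ ⟨
  G =ˢ S                               ∎

count-=ˢ : (S : Subset n) → count (_=ˢ S) (allSubsets n) ≡ 1
count-=ˢ {zero}  []      = refl
count-=ˢ {suc n} (b ∷ S) = begin
  count (_=ˢ (b ∷ S)) (List.map (inside ∷_) Ss List.++ List.map (outside ∷_) Ss)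
    ≡⟨ count-++ _ (List.map (inside ∷_) Ss) _ ⟩
  count (_=ˢ (b ∷ S)) (List.map (inside ∷_) Ss) + count (_=ˢ (b ∷ S)) (List.map (outside ∷_) Ss)
    ≡⟨ cong₂ _+_ (count-map _ _ Ss) (count-map _ _ Ss) ⟩
  count (λ G → (inside ∷ G) =ˢ (b ∷ S)) Ss + count (λ G → (outside ∷ G) =ˢ (b ∷ S)) Ss
    ≡⟨ by-head b ⟩
  1 ∎
  where
  Ss : List (Subset n)
  Ss = allSubsets n
  tail-count : ∀ b → count (λ G → (b ∷ G) =ˢ (b ∷ S)) Ss ≡ 1
  tail-count b = trans (count-cong (λ G → ∷-=ˢ-∷ b G S) Ss) (count-=ˢ S)
  by-head : ∀ b → count (λ G → (inside ∷ G) =ˢ (b ∷ S)) Ss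
                  + count (λ G → (outside ∷ G) =ˢ (b ∷ S)) Ss ≡ 1
  by-head inside  = cong₂ _+_ (tail-count inside) (count-false Ss)
  by-head outside = cong₂ _+_ (count-false Ss) (tail-count outside)

card-=ˢ-∧ : (S : Subset n) (b : Bool) → card (λ G → (G =ˢ S) ∧ b) ≡ ⟦ b ⟧
card-=ˢ-∧ S true  =
  trans (card-cong (λ G → ∧-identityʳ (G =ˢ S))) (trans (card≡count (_=ˢ S)) (count-=ˢ S))
card-=ˢ-∧ {n} S false = trans (card-cong (λ G → ∧-zeroʳ (G =ˢ S))) (card-false {n})

card-insert : (S : Subset n) (b : Bool) (R : Family n) → R S ≡ false
  → card (λ G → ((G =ˢ S) ∧ b) ∨ R G) ≡ ⟦ b ⟧ + card R
card-insert S b R RS≡false = trans (card-∨ disjoint) (cong (_+ card R) (card-=ˢ-∧ S b))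
  where
  disjoint : ∀ G → ((G =ˢ S) ∧ b) ∧ R G ≡ false
  disjoint G with ≡-dec _≟_ G S
  ... | yes refl = trans (cong (b ∧_) RS≡false) (∧-zeroʳ b)
  ... | no  _    = refl

card-∖ᶠ : (F : Family n) (D : Subset n) → ⟦ F D ⟧ + card (F ∖ᶠ D) ≡ card F
card-∖ᶠ F D = sym (begin
  card F                                       ≡⟨ card-cong split ⟩
  card (λ G → ((G =ˢ D) ∧ F D) ∨ (F ∖ᶠ D) G)  ≡⟨ card-insert D (F D) (F ∖ᶠ D) D∉F∖D ⟩
  ⟦ F D ⟧ + card (F ∖ᶠ D)                      ∎)
  where
  split : ∀ G → F G ≡ ((G =ˢ D) ∧ F D) ∨ (F G ∧ not (G =ˢ D))
  split G with ≡-dec _≟_ G D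
  ... | no _     = sym (∧-identityʳ (F G))
  ... | yes refl with F G
  ...   | true  = refl
  ...   | false = refl
  D∉F∖D : (F ∖ᶠ D) D ≡ false
  D∉F∖D = trans (cong (λ b → F D ∧ not b) (=ˢ-refl D)) (∧-zeroʳ (F D))

-- Families listed by their members

-- Written without a trailing `∨ false` so that ℰ A B is definitionally oneOf (ℰ-sets A B).
oneOf : List (Subset n) → Family n
oneOf []            G = false
oneOf (E ∷ [])      G = G =ˢ E
oneOf (E ∷ E′ ∷ Es) G = (G =ˢ E) ∨ oneOf (E′ ∷ Es) G

Distinct : List (Subset n) → Set
Distinct = AllPairs (λ E E′ → E =ˢ E′ ≡ false)

oneOf⇒∈ : (Es : List (Subset n)) {G : Subset n} → T (oneOf Es G) → G ∈ₗ Es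
oneOf⇒∈ (E ∷ [])          G∈Es = here (toWitness G∈Es)
oneOf⇒∈ (E ∷ Es@(_ ∷ _)) G∈Es =
  [ here ∘ toWitness , there ∘ oneOf⇒∈ Es ]′ (Equivalence.to T-∨ G∈Es)

oneOf-∉ : {E : Subset n} {Es : List (Subset n)} → All (λ E′ → E =ˢ E′ ≡ false) Es
  → oneOf Es E ≡ false
oneOf-∉ []                     = refl
oneOf-∉ (E≠E′ ∷ [])            = E≠E′
oneOf-∉ (E≠E′ ∷ E∉Es@(_ ∷ _)) = cong₂ _∨_ E≠E′ (oneOf-∉ E∉Es)

card-oneOf-∧ : (Es : List (Subset n)) → Distinct Es → (β : Family n)
  → card (λ G → oneOf Es G ∧ β G) ≡ count β Es
card-oneOf-∧ {n} [] _ β = card-false {n}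
card-oneOf-∧ (E ∷ []) _ β =
  trans (card-cong (λ G → =ˢ-∧ G E β)) (trans (card-=ˢ-∧ E (β E)) (sym (+-identityʳ _)))
card-oneOf-∧ (E ∷ E′ ∷ Es) (E∉Es ∷ distinct) β = begin
  card (λ G → oneOf (E ∷ E′ ∷ Es) G ∧ β G)
    ≡⟨ card-cong split ⟩
  card (λ G → ((G =ˢ E) ∧ β E) ∨ (oneOf (E′ ∷ Es) G ∧ β G))
    ≡⟨ card-insert E (β E) _ (cong (_∧ β E) (oneOf-∉ E∉Es)) ⟩
  ⟦ β E ⟧ + card (λ G → oneOf (E′ ∷ Es) G ∧ β G)
    ≡⟨ cong (⟦ β E ⟧ +_) (card-oneOf-∧ (E′ ∷ Es) distinct β) ⟩
  count β (E ∷ E′ ∷ Es) ∎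
  where
  split : ∀ G → oneOf (E ∷ E′ ∷ Es) G ∧ β G ≡ ((G =ˢ E) ∧ β E) ∨ (oneOf (E′ ∷ Es) G ∧ β G)
  split G = trans (∧-distribʳ-∨ (β G) (G =ˢ E) _) (cong (_∨ _) (=ˢ-∧ G E β))

𝒟-oneOf : (Es : List (Subset n)) (H : Subset n) (t : ℕ) {β : Family n}
  → All (λ E → (∣ E ∩ H ∣ <ᵇ t) ≡ β E) Es
  → ∀ G → 𝒟 (oneOf Es) H t G ≡ oneOf Es G ∧ β G
𝒟-oneOf Es H t agree G with oneOf Es G in G∈Es
... | true  = All.lookup agree (oneOf⇒∈ Es (Equivalence.from T-≡ G∈Es))
... | false = refl

card-𝒟-oneOf : (Es : List (Subset n)) (H : Subset n) (t : ℕ) {β : Family n}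
  → Distinct Es → All (λ E → (∣ E ∩ H ∣ <ᵇ t) ≡ β E) Es
  → card (𝒟 (oneOf Es) H t) ≡ count β Es
card-𝒟-oneOf Es H t {β} distinct agree =
  trans (card-cong (𝒟-oneOf Es H t agree)) (card-oneOf-∧ Es distinct β)

card-𝒟-∖ᶠ : (F : Family n) (D H : Subset n) (t : ℕ)
  → ⟦ 𝒟 F H t D ⟧ + card (𝒟 (F ∖ᶠ D) H t) ≡ card (𝒟 F H t)
card-𝒟-∖ᶠ F D H t =
  trans (cong (⟦ 𝒟 F H t D ⟧ +_) (card-cong commute)) (card-∖ᶠ (𝒟 F H t) D)
  where
  commute : ∀ G → 𝒟 (F ∖ᶠ D) H t G ≡ (𝒟 F H t ∖ᶠ D) G
  commute G with F G
  ... | true  = ∧-comm (not (G =ˢ D)) (∣ G ∩ H ∣ <ᵇ t)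
  ... | false = refl

-- Subsets of [k + m] as a block of [k] followed by a block of [m]

∣++∣ : (p : Subset k) (q : Subset m) → ∣ p ++ q ∣ ≡ ∣ p ∣ + ∣ q ∣
∣++∣ []            q = refl
∣++∣ (inside  ∷ p) q = cong suc (∣++∣ p q)
∣++∣ (outside ∷ p) q = ∣++∣ p q

∣∩∣-++ : (p p′ : Subset k) (q q′ : Subset m)
  → ∣ (p ++ q) ∩ (p′ ++ q′) ∣ ≡ ∣ p ∩ p′ ∣ + ∣ q ∩ q′ ∣
∣∩∣-++ p p′ q q′ = trans (cong ∣_∣ (zipWith-++ _∧_ p q p′ q′)) (∣++∣ (p ∩ p′) (q ∩ q′))

∈ᵇ≡lookup : (x : Fin n) (p : Subset n) → x ∈ᵇ p ≡ lookup p x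
∈ᵇ≡lookup zero    (inside  ∷ p) = refl
∈ᵇ≡lookup zero    (outside ∷ p) = refl
∈ᵇ≡lookup (suc x) (_ ∷ p)       = trans (⌊⌋-map′ _ _ (x ∈? p)) (∈ᵇ≡lookup x p)

↑ˡ-∈ᵇ-++ : (p : Subset k) (q : Subset m) (x : Fin k) → (x ↑ˡ m) ∈ᵇ (p ++ q) ≡ lookup p x
↑ˡ-∈ᵇ-++ p q x = trans (∈ᵇ≡lookup _ (p ++ q)) (lookup-++ˡ p q x)

∣∩⊥∣ : (p : Subset n) → ∣ p ∩ ⊥ ∣ ≡ 0
∣∩⊥∣ {n} p = trans (cong ∣_∣ (∩-zeroʳ p)) (∣⊥∣≡0 n)

∣∩⁅⁆∣ : (p : Subset n) (x : Fin n) → ∣ p ∩ ⁅ x ⁆ ∣ ≡ ⟦ lookup p x ⟧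
∣∩⁅⁆∣ (inside  ∷ p) zero    = cong suc (∣∩⊥∣ p)
∣∩⁅⁆∣ (outside ∷ p) zero    = ∣∩⊥∣ p
∣∩⁅⁆∣ (inside  ∷ p) (suc x) = ∣∩⁅⁆∣ p x
∣∩⁅⁆∣ (outside ∷ p) (suc x) = ∣∩⁅⁆∣ p x

⟦lookup⟧+∣-∣ : (p : Subset n) (x : Fin n) → ⟦ lookup p x ⟧ + ∣ p - x ∣ ≡ ∣ p ∣
⟦lookup⟧+∣-∣ (inside  ∷ p) zero    = cong (suc ∘ ∣_∣) (p─⊥≡p p)
⟦lookup⟧+∣-∣ (outside ∷ p) zero    = cong ∣_∣ (p─⊥≡p p)
⟦lookup⟧+∣-∣ (inside  ∷ p) (suc x) = trans (+-suc _ _) (cong suc (⟦lookup⟧+∣-∣ p x))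
⟦lookup⟧+∣-∣ (outside ∷ p) (suc x) = ⟦lookup⟧+∣-∣ p x

∩-─ : (p q r : Subset n) → p ∩ (q ─ r) ≡ (p ∩ q) ─ r
∩-─ []      []      []            = refl
∩-─ (a ∷ p) (_ ∷ q) (inside  ∷ r) = cong₂ _∷_ (∧-zeroʳ a) (∩-─ p q r)
∩-─ (_ ∷ p) (_ ∷ q) (outside ∷ r) = cong (_ ∷_) (∩-─ p q r)

∩⊆∪ : {p q : Subset n} {x : Fin n} → x ∈ p ∩ q → x ∈ p ∪ q
∩⊆∪ {p = p} {q} x∈p∩q = x∈p∪q⁺ (inj₁ (proj₁ (x∈p∩q⁻ p q x∈p∩q)))

≥⇒↑ʳ : ∀ k (x : Fin (k + m)) → k ≤ toℕ x → ∃[ y ] x ≡ k ↑ʳ y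
≥⇒↑ʳ zero    x       _         = x , refl
≥⇒↑ʳ (suc k) (suc x) (s≤s k≤x) with y , refl ← ≥⇒↑ʳ k x k≤x = y , refl

-- p and q are explicit: _─_ zips with a local function of both arguments,
-- so they cannot be read off the reduced type of a tail.
─-head-inside : ∀ a b (p q : Subset n) {r} → (a ∷ p) ─ (b ∷ q) ≡ inside ∷ r
  → a ≡ inside × b ≡ outside
─-head-inside inside  outside _ _ _  = refl , refl
─-head-inside outside outside _ _ ()
─-head-inside _       inside  _ _ ()

─≡⊥-antisym : (p q : Subset n) → p ─ q ≡ ⊥ → q ─ p ≡ ⊥ → p ≡ q
─≡⊥-antisym []            []            _     _     = refl
─≡⊥-antisym (inside  ∷ p) (inside  ∷ q) p─q≡⊥ q─p≡⊥ =
  cong (inside ∷_) (─≡⊥-antisym p q (∷-injectiveʳ p─q≡⊥) (∷-injectiveʳ q─p≡⊥))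
─≡⊥-antisym (outside ∷ p) (outside ∷ q) p─q≡⊥ q─p≡⊥ =
  cong (outside ∷_) (─≡⊥-antisym p q (∷-injectiveʳ p─q≡⊥) (∷-injectiveʳ q─p≡⊥))
─≡⊥-antisym (inside  ∷ p) (outside ∷ q) () _
─≡⊥-antisym (outside ∷ p) (inside  ∷ q) _  ()

∷⁴-injectiveʳ : ∀ {a b c d a′ b′ c′ d′} {p q : Subset m}
  → a ∷ b ∷ c ∷ d ∷ p ≡ a′ ∷ b′ ∷ c′ ∷ d′ ∷ q → p ≡ q
∷⁴-injectiveʳ = ∷-injectiveʳ ∘ ∷-injectiveʳ ∘ ∷-injectiveʳ ∘ ∷-injectiveʳ

module _ (S : Subset k) (C : Subset m) (i : Fin k) (y : Fin m) where

  meet-outside : (∣ (S ++ C) ∩ (⁅ i ⁆ ++ (C ∪ ⁅ y ⁆)) ∣ <ᵇ suc ∣ C ∣)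
               ≡ not ((i ↑ˡ m) ∈ᵇ (S ++ C))
  meet-outside = begin
    ∣ (S ++ C) ∩ (⁅ i ⁆ ++ (C ∪ ⁅ y ⁆)) ∣ <ᵇ suc ∣ C ∣
      ≡⟨ cong (_<ᵇ suc ∣ C ∣) size ⟩
    ⟦ lookup S i ⟧ + ∣ C ∣ <ᵇ suc ∣ C ∣
      ≡⟨ <ᵇ-by-⟦⟧ (not (lookup S i)) (⟦not⟧+⟦⟧+ (lookup S i) ∣ C ∣) ⟩
    not (lookup S i)
      ≡⟨ cong not (↑ˡ-∈ᵇ-++ S C i) ⟨
    not ((i ↑ˡ m) ∈ᵇ (S ++ C)) ∎
    where
    size : ∣ (S ++ C) ∩ (⁅ i ⁆ ++ (C ∪ ⁅ y ⁆)) ∣ ≡ ⟦ lookup S i ⟧ + ∣ C ∣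
    size = trans (∣∩∣-++ S ⁅ i ⁆ C (C ∪ ⁅ y ⁆))
                 (cong₂ _+_ (∣∩⁅⁆∣ S i) (cong ∣_∣ (∩-abs-∪ C ⁅ y ⁆)))

  meet-inside : ∣ S ∣ ≡ 2 → lookup C y ≡ true
    → (∣ (S ++ C) ∩ ((⊤ - i) ++ (C - y)) ∣ <ᵇ suc ∣ C ∣) ≡ (i ↑ˡ m) ∈ᵇ (S ++ C)
  meet-inside ∣S∣≡2 y∈C = trans (<ᵇ-by-⟦⟧ (lookup S i) size) (sym (↑ˡ-∈ᵇ-++ S C i))
    where
    size : ⟦ lookup S i ⟧ + ∣ (S ++ C) ∩ ((⊤ - i) ++ (C - y)) ∣ ≡ suc ∣ C ∣
    size = begin
      ⟦ lookup S i ⟧ + ∣ (S ++ C) ∩ ((⊤ - i) ++ (C - y)) ∣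
        ≡⟨ cong (⟦ lookup S i ⟧ +_) (∣∩∣-++ S (⊤ - i) C (C - y)) ⟩
      ⟦ lookup S i ⟧ + (∣ S ∩ (⊤ - i) ∣ + ∣ C ∩ (C - y) ∣)
        ≡⟨ cong₂ (λ P Q → ⟦ lookup S i ⟧ + (∣ P ∣ + ∣ Q ∣))
                 (trans (∩-─ S ⊤ ⁅ i ⁆) (cong (_─ ⁅ i ⁆) (∩-identityʳ S)))
                 (trans (∩-─ C C ⁅ y ⁆) (cong (_─ ⁅ y ⁆) (∩-idem C))) ⟩
      ⟦ lookup S i ⟧ + (∣ S - i ∣ + ∣ C - y ∣)
        ≡⟨ +-assoc ⟦ lookup S i ⟧ ∣ S - i ∣ ∣ C - y ∣ ⟨
      ⟦ lookup S i ⟧ + ∣ S - i ∣ + ∣ C - y ∣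
        ≡⟨ cong (_+ ∣ C - y ∣) (trans (⟦lookup⟧+∣-∣ S i) ∣S∣≡2) ⟩
      suc (⟦ true ⟧ + ∣ C - y ∣)
        ≡⟨ cong (λ b → suc (⟦ b ⟧ + ∣ C - y ∣)) y∈C ⟨
      suc (⟦ lookup C y ⟧ + ∣ C - y ∣)
        ≡⟨ cong suc (⟦lookup⟧+∣-∣ C y) ⟩
      suc ∣ C ∣ ∎

-- The configuration of the lemma

A[_] B[_] : Subset m → Subset (4 + m)
A[ C ] = (⁅ # 0 ⁆ ∪ ⁅ # 1 ⁆) ++ C
B[ C ] = (⁅ # 2 ⁆ ∪ ⁅ # 3 ⁆) ++ C

split-A-B : (A B : Subset (4 + m))
  → A ─ B ≡ ⁅ ι (# 0) ⁆ ∪ ⁅ ι (# 1) ⁆ → B ─ A ≡ ⁅ ι (# 2) ⁆ ∪ ⁅ ι (# 3) ⁆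
  → ∃[ C ] A ≡ A[ C ] × B ≡ B[ C ]
split-A-B (a₀ ∷ a₁ ∷ a₂ ∷ a₃ ∷ A′) (b₀ ∷ b₁ ∷ b₂ ∷ b₃ ∷ B′) A─B B─A
  with refl , refl ← ─-head-inside a₀ b₀ (a₁ ∷ a₂ ∷ a₃ ∷ A′) (b₁ ∷ b₂ ∷ b₃ ∷ B′) A─B
     | refl , refl ← ─-head-inside a₁ b₁ (a₂ ∷ a₃ ∷ A′) (b₂ ∷ b₃ ∷ B′) (∷-injectiveʳ A─B)
     | refl , refl ← ─-head-inside b₂ a₂ (b₃ ∷ B′) (a₃ ∷ A′) (∷-injectiveʳ (∷-injectiveʳ B─A))
     | refl , refl ← ─-head-inside b₃ a₃ B′ A′ (∷-injectiveʳ (∷-injectiveʳ (∷-injectiveʳ B─A)))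
     | refl ← ─≡⊥-antisym A′ B′ (trans (∷⁴-injectiveʳ A─B) (∪-idem ⊥))
                                (trans (∷⁴-injectiveʳ B─A) (∪-idem ⊥))
  = A′ , refl , refl

ℰ-sets : (A B : Subset (4 + m)) → List (Subset (4 + m))
ℰ-sets A B =
  X A B (ι (# 0)) (ι (# 1)) ∷ X A B (ι (# 0)) (ι (# 2)) ∷ X A B (ι (# 0)) (ι (# 3)) ∷
  X A B (ι (# 1)) (ι (# 2)) ∷ X A B (ι (# 1)) (ι (# 3)) ∷ X A B (ι (# 2)) (ι (# 3)) ∷ []

pairs : List (Subset 4)
pairs =
  ⁅ # 0 ⁆ ∪ ⁅ # 1 ⁆ ∷ ⁅ # 0 ⁆ ∪ ⁅ # 2 ⁆ ∷ ⁅ # 0 ⁆ ∪ ⁅ # 3 ⁆ ∷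
  ⁅ # 1 ⁆ ∪ ⁅ # 2 ⁆ ∷ ⁅ # 1 ⁆ ∪ ⁅ # 3 ⁆ ∷ ⁅ # 2 ⁆ ∪ ⁅ # 3 ⁆ ∷ []

I-outside : {A B : Subset (4 + m)} {i : Fin 4} {x : Fin (4 + m)}
  → x ∉ A ∩ B → x ∉ A ∪ B → I A B i x ⇔ (i ≡ # 1 ⊎ i ≡ # 3)
I-outside x∉A∩B x∉A∪B =
  mk⇔ [ (λ (_ , x∈A∩B) → contradiction x∈A∩B x∉A∩B) , proj₁ ]′ (λ i∈ → inj₂ (i∈ , x∉A∪B))

I-inside : {A B : Subset (4 + m)} {i : Fin 4} {x : Fin (4 + m)}
  → x ∈ A ∩ B → I A B i x ⇔ (i ≡ # 0 ⊎ i ≡ # 2)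
I-inside x∈A∩B =
  mk⇔ [ proj₁ , (λ (_ , x∉A∪B) → contradiction (∩⊆∪ x∈A∩B) x∉A∪B) ]′ (λ i∈ → inj₁ (i∈ , x∈A∩B))

Part-i : (t : ℕ) (A B : Subset (4 + m)) (i : Fin 4) (x : Fin (4 + m)) → Set
Part-i t A B i x =
  card (𝒟 (ℰ A B) (X A B (ι i) x) t) ≡ 3
  × (x ∉ (A ∪ B) → ∀ G → 𝒟 (ℰ A B) (X A B (ι i) x) t G ≡ (ℰ A B G ∧ not (ι i ∈ᵇ G)))
  × (x ∈ (A ∩ B) → ∀ G → 𝒟 (ℰ A B) (X A B (ι i) x) t G ≡ (ℰ A B G ∧ (ι i ∈ᵇ G)))

Part-ii : (t : ℕ) (A B : Subset (4 + m)) (i : Fin 4) (x : Fin (4 + m)) → Set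
Part-ii t A B i x = 2 ≤ d × d ≤ 3 × (d ≡ 3 ⇔ I A B i x)
  where
  d : ℕ
  d = card (𝒟 (ℰ A B ∖ᶠ X A B (ι (# 1)) (ι (# 3))) (X A B (ι i) x) t)

module Configuration {m : ℕ} (C : Subset m) where

  A B : Subset (4 + m)
  A = A[ C ]
  B = B[ C ]

  X₂₄ : Subset (4 + m)
  X₂₄ = X A B (ι (# 1)) (ι (# 3))

  ℰ-sets-distinct : Distinct (ℰ-sets A B)
  ℰ-sets-distinct =
    (refl ∷ refl ∷ refl ∷ refl ∷ refl ∷ []) ∷ (refl ∷ refl ∷ refl ∷ refl ∷ []) ∷
    (refl ∷ refl ∷ refl ∷ []) ∷ (refl ∷ refl ∷ []) ∷ (refl ∷ []) ∷ [] ∷ []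

  ℰ∋X₂₄ : ℰ A B X₂₄ ≡ true
  ℰ∋X₂₄ = cong (_∨ _) (=ˢ-refl X₂₄)

  -- Each X_{j,k} computes to its pair followed by the tail (C ∩ C) ∪ (⊥ ∪ ⊥).
  ℰ-sets-blocks : ℰ-sets A B ≡ List.map (_++ C) pairs
  ℰ-sets-blocks =
    cong (λ T → List.map (_++ T) pairs) (trans (cong₂ _∪_ (∩-idem C) (∪-idem ⊥)) (∪-identityʳ C))

  all-ℰ-sets : {P : Subset (4 + m) → Set} → (∀ S → ∣ S ∣ ≡ 2 → P (S ++ C)) → All P (ℰ-sets A B)
  all-ℰ-sets {P} P-blocks =
    subst (All P) (sym ℰ-sets-blocks) (map⁺ (All.map (λ {S} → P-blocks S) pairs-have-size-2))
    where
    pairs-have-size-2 : All (λ S → ∣ S ∣ ≡ 2) pairs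
    pairs-have-size-2 = refl ∷ refl ∷ refl ∷ refl ∷ refl ∷ refl ∷ []

  in-three : ∀ i → count (ι i ∈ᵇ_) (ℰ-sets A B) ≡ 3
  in-three zero                   = refl
  in-three (suc zero)             = refl
  in-three (suc (suc zero))       = refl
  in-three (suc (suc (suc zero))) = refl

  out-of-three : ∀ i → count (λ E → not (ι i ∈ᵇ E)) (ℰ-sets A B) ≡ 3
  out-of-three zero                   = refl
  out-of-three (suc zero)             = refl
  out-of-three (suc (suc zero))       = refl
  out-of-three (suc (suc (suc zero))) = refl

  ∈X₂₄⇔ : ∀ i → not (ι i ∈ᵇ X₂₄) ≡ false ⇔ (i ≡ # 1 ⊎ i ≡ # 3)
  ∈X₂₄⇔ zero                   = mk⇔ (λ ()) λ { (inj₁ ()) ; (inj₂ ()) }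
  ∈X₂₄⇔ (suc zero)             = mk⇔ (λ _ → inj₁ refl) (λ _ → refl)
  ∈X₂₄⇔ (suc (suc zero))       = mk⇔ (λ ()) λ { (inj₁ ()) ; (inj₂ ()) }
  ∈X₂₄⇔ (suc (suc (suc zero))) = mk⇔ (λ _ → inj₂ refl) (λ _ → refl)

  ∉X₂₄⇔ : ∀ i → ι i ∈ᵇ X₂₄ ≡ false ⇔ (i ≡ # 0 ⊎ i ≡ # 2)
  ∉X₂₄⇔ zero                   = mk⇔ (λ _ → inj₁ refl) (λ _ → refl)
  ∉X₂₄⇔ (suc zero)             = mk⇔ (λ ()) λ { (inj₁ ()) ; (inj₂ ()) }
  ∉X₂₄⇔ (suc (suc zero))       = mk⇔ (λ _ → inj₂ refl) (λ _ → refl)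
  ∉X₂₄⇔ (suc (suc (suc zero))) = mk⇔ (λ ()) λ { (inj₁ ()) ; (inj₂ ()) }

  module _ (i : Fin 4) (y : Fin m) where

    x : Fin (4 + m)
    x = 4 ↑ʳ y

    H : Subset (4 + m)
    H = X A B (ι i) x

    H-outside : y ∉ C → H ≡ ⁅ i ⁆ ++ (C ∪ ⁅ y ⁆)
    H-outside y∉C with y ∈? C ∩ C
    ... | yes y∈C∩C = contradiction (proj₁ (x∈p∩q⁻ C C y∈C∩C)) y∉C
    ... | no  _     = trans (raw i) (cong (⁅ i ⁆ ++_) (cong₂ _∪_ (∩-idem C) (∪-identityˡ ⁅ y ⁆)))
      where
      raw : ∀ i → (A ∩ B) ∪ (⁅ ι i ⁆ ∪ ⁅ x ⁆) ≡ ⁅ i ⁆ ++ ((C ∩ C) ∪ (⊥ ∪ ⁅ y ⁆))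
      raw zero                   = refl
      raw (suc zero)             = refl
      raw (suc (suc zero))       = refl
      raw (suc (suc (suc zero))) = refl

    H-inside : y ∈ C → H ≡ (⊤ - i) ++ (C - y)
    H-inside y∈C with y ∈? C ∩ C
    ... | no  y∉C∩C = contradiction (x∈p∩q⁺ (y∈C , y∈C)) y∉C∩C
    ... | yes _     = trans (raw i) (cong ((⊤ - i) ++_) (cong₂ _─_ (∪-idem C) (∪-identityˡ ⁅ y ⁆)))
      where
      raw : ∀ i → (A ∪ B) ─ (⁅ ι i ⁆ ∪ ⁅ x ⁆) ≡ (⊤ - i) ++ ((C ∪ C) ─ (⊥ ∪ ⁅ y ⁆))
      raw zero                   = refl
      raw (suc zero)             = refl
      raw (suc (suc zero))       = refl
      raw (suc (suc (suc zero))) = refl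

    x∈A∩B : y ∈ C → x ∈ A ∩ B
    x∈A∩B y∈C = there (there (there (there (x∈p∩q⁺ (y∈C , y∈C)))))

    x∉A∩B : y ∉ C → x ∉ A ∩ B
    x∉A∩B y∉C (there (there (there (there y∈C∩C)))) = y∉C (proj₁ (x∈p∩q⁻ C C y∈C∩C))

    x∉A∪B : y ∉ C → x ∉ A ∪ B
    x∉A∪B y∉C (there (there (there (there y∈C∪C)))) = y∉C (reduce (x∈p∪q⁻ C C y∈C∪C))

    agree-outside : y ∉ C → All (λ E → (∣ E ∩ H ∣ <ᵇ suc ∣ C ∣) ≡ not (ι i ∈ᵇ E)) (ℰ-sets A B)
    agree-outside y∉C rewrite H-outside y∉C = all-ℰ-sets (λ S _ → meet-outside S C i y)

    agree-inside : y ∈ C → All (λ E → (∣ E ∩ H ∣ <ᵇ suc ∣ C ∣) ≡ ι i ∈ᵇ E) (ℰ-sets A B)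
    agree-inside y∈C rewrite H-inside y∈C =
      all-ℰ-sets (λ S ∣S∣≡2 → meet-inside S C i y ∣S∣≡2 ([]=⇒lookup y∈C))

    module Agreement (β : Family (4 + m))
                     (agree : All (λ E → (∣ E ∩ H ∣ <ᵇ suc ∣ C ∣) ≡ β E) (ℰ-sets A B))
                     (three : count β (ℰ-sets A B) ≡ 3)
                     (I⇔ : β X₂₄ ≡ false ⇔ I A B i x) where

      card-𝒟 : card (𝒟 (ℰ A B) H (suc ∣ C ∣)) ≡ 3
      card-𝒟 = trans (card-𝒟-oneOf (ℰ-sets A B) H (suc ∣ C ∣) ℰ-sets-distinct agree) three

      𝒟≗ : ∀ G → 𝒟 (ℰ A B) H (suc ∣ C ∣) G ≡ ℰ A B G ∧ β G
      𝒟≗ = 𝒟-oneOf (ℰ-sets A B) H (suc ∣ C ∣) agree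

      part-ii : Part-ii (suc ∣ C ∣) A B i x
      part-ii = two-or-three (begin
        ⟦ β X₂₄ ⟧ + card (𝒟 (ℰ A B ∖ᶠ X₂₄) H (suc ∣ C ∣))
          ≡⟨ cong (λ b → ⟦ b ⟧ + _) (trans (𝒟≗ X₂₄) (cong (_∧ β X₂₄) ℰ∋X₂₄)) ⟨
        ⟦ 𝒟 (ℰ A B) H (suc ∣ C ∣) X₂₄ ⟧ + card (𝒟 (ℰ A B ∖ᶠ X₂₄) H (suc ∣ C ∣))
          ≡⟨ card-𝒟-∖ᶠ (ℰ A B) X₂₄ H (suc ∣ C ∣) ⟩
        card (𝒟 (ℰ A B) H (suc ∣ C ∣))
          ≡⟨ card-𝒟 ⟩
        3 ∎) I⇔

    case-x∉A∪B : y ∉ C → Part-i (suc ∣ C ∣) A B i x × Part-ii (suc ∣ C ∣) A B i x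
    case-x∉A∪B y∉C =
      (card-𝒟 , (λ _ → 𝒟≗) , (λ x∈A∩B → contradiction x∈A∩B (x∉A∩B y∉C))) , part-ii
      where
      open Agreement (λ E → not (ι i ∈ᵇ E)) (agree-outside y∉C) (out-of-three i)
        (⇔-sym (I-outside {A = A} {B} (x∉A∩B y∉C) (x∉A∪B y∉C)) ⇔-∘ ∈X₂₄⇔ i)

    case-x∈A∩B : y ∈ C → Part-i (suc ∣ C ∣) A B i x × Part-ii (suc ∣ C ∣) A B i x
    case-x∈A∩B y∈C =
      (card-𝒟 , (λ x∉A∪B → contradiction (∩⊆∪ {p = A} {B} (x∈A∩B y∈C)) x∉A∪B) , (λ _ → 𝒟≗))
      , part-ii
      where
      open Agreement (ι i ∈ᵇ_) (agree-inside y∈C) (in-three i)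
        (⇔-sym (I-inside {A = A} {B} (x∈A∩B y∈C)) ⇔-∘ ∉X₂₄⇔ i)

lemma6p3 : (m t : ℕ) → 1 ≤ t → (A B : Subset (4 + m))
    → ∣ A ∣ ≡ suc t → ∣ B ∣ ≡ suc t
    → A ─ B ≡ ⁅ ι (# 0) ⁆ ∪ ⁅ ι (# 1) ⁆
    → B ─ A ≡ ⁅ ι (# 2) ⁆ ∪ ⁅ ι (# 3) ⁆
    → (i : Fin 4) (x : Fin (4 + m)) → 4 ≤ toℕ x
    → (card (𝒟 (ℰ A B) (X A B (ι i) x) t) ≡ 3
        × (x ∉ (A ∪ B) → ∀ G → 𝒟 (ℰ A B) (X A B (ι i) x) t G ≡ (ℰ A B G ∧ not (ι i ∈ᵇ G)))
        × (x ∈ (A ∩ B) → ∀ G → 𝒟 (ℰ A B) (X A B (ι i) x) t G ≡ (ℰ A B G ∧ (ι i ∈ᵇ G))))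
      × (2 ≤ card (𝒟 (ℰ A B ∖ᶠ X A B (ι (# 1)) (ι (# 3))) (X A B (ι i) x) t)
        × card (𝒟 (ℰ A B ∖ᶠ X A B (ι (# 1)) (ι (# 3))) (X A B (ι i) x) t) ≤ 3
        × (card (𝒟 (ℰ A B ∖ᶠ X A B (ι (# 1)) (ι (# 3))) (X A B (ι i) x) t) ≡ 3 ⇔ I A B i x))
lemma6p3 m t _ A B ∣A∣≡1+t _ A─B B─A i x 4≤x
  with C , refl , refl ← split-A-B A B A─B B─A
     | y , refl ← ≥⇒↑ʳ 4 x 4≤x
  with refl ← ∣A∣≡1+t
  with y ∈? C
... | yes y∈C = Configuration.case-x∈A∩B C i y y∈C
... | no  y∉C = Configuration.case-x∉A∪B C i y y∉C
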